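{- Let $j$ and $n$ be non-negative integers, and let $\{(s_k),(\sigma_k)\}$, $k=0,1,2,\ldots$, be a binomial-transform pair of the first kind. Then \[ \sum_{k=0}^n(-1)^{n-k}\binom nk\binom{n-k}{j}2^k s_k=\sum_{k=0}^n(-1)^{j-k}\binom nk\binom{n-k}{j}2^k\sigma_k. \]
   Context: Two sequences $(s_k)_{k\ge0}$ and $(\sigma_k)_{k\ge0}$ of complex numbers form a binomial-transform pair of the first kind if $\sigma_n=\sum_{k=0}^n(-1)^k\binom nk s_k$ for every non-negative integer $n$. $\binom ab=0$ for integers $0\le a<b$. -}

module Defs where

open import Level using (Level)
open import Data.Nat as ℕ using (ℕ; zero; suc)
open import Data.Nat.Combinatorics using (_C_)
open import Algebra.Bundles using (CommutativeRing)

module _ {c ℓ : Level} (R : CommutativeRing c ℓ) where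
  open CommutativeRing R hiding (zero)

  neg1^ : ℕ → Carrier
  neg1^ zero    = 1#
  neg1^ (suc m) = - (neg1^ m)

  -- the integer (-1)^(a - b) for naturals a b; since (-1)^(-m) = (-1)^m,
  -- this equals (-1)^(a + b)
  signDiff : ℕ → ℕ → Carrier
  signDiff a b = neg1^ (a ℕ.+ b)

  fromℕ : ℕ → Carrier
  fromℕ zero    = 0#
  fromℕ (suc m) = 1# + fromℕ m

  Σ≤ : ℕ → (ℕ → Carrier) → Carrier
  Σ≤ zero    f = f zero
  Σ≤ (suc n) f = Σ≤ n f + f (suc n)

  BinomialPair₁ : (ℕ → Carrier) → (ℕ → Carrier) → Set ℓ
  BinomialPair₁ s σ = ∀ n → σ n ≈ Σ≤ n (λ k → neg1^ k * (fromℕ (n C k) * s k))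

{-# OPTIONS --safe #-}
module Submission where

-- Write n = j + m (if j > n every term vanishes, as (n ∸ k) C j = 0). The trinomial revision
-- C(n,k) C(n-k,j) = C(n,j) C(m,k) turns both sides into C(n,j) (-1)^j times binomial sums of
-- length m, so it remains to show  Σ_k C(m,k) (-2)^k σ_k = Σ_k C(m,k) (-1)^(m-k) 2^k s_k.
-- This is the case c = -2 of  Σ_k C(m,k) c^k σ_k = Σ_k C(m,k) (-c)^k (1+c)^(m-k) s_k.
-- Regarded as functions of m and the sequence s, both sides satisfy
-- X (m+1) s = (1+c) X m s - c X m (s ∘ suc): on the left by Pascal's rule and
-- σ_(k+1) = σ_k - σ'_k, where σ' is the transform of s ∘ suc; on the right by Pascal's rule
-- alone. Both sides also agree at m = 0.

open import Level using (Level; _⊔_)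
open import Function.Base using (_∘_)
open import Data.Product.Base using (_,_)
open import Data.Nat.Base as ℕ using (ℕ; zero; suc; _∸_; _≤_; _<_; z≤n; s≤s)
open import Data.Nat.Properties as ℕ using (≤-refl; m≤n⇒m≤1+n)
open import Data.Nat.Combinatorics using (_C_; k>n⇒nCk≡0; nCk+nC[k+1]≡[n+1]C[k+1])
open import Relation.Binary.PropositionalEquality as ≡ using (_≡_)
open import Relation.Nullary.Decidable using (yes; no)
open import Algebra.Bundles using (CommutativeRing)
open import Defs

module _ where
  open import Data.Nat.Base
  open import Data.Nat.Properties
  open import Data.Nat.Combinatorics
  open import Data.Nat.DivMod using (_/_; m/n*n≡m)
  open import Data.Nat.Tactic.RingSolver using () renaming (solve-∀ to ℕ-solve-∀)
  open ≡ using (cong; cong₂; sym; trans)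
  open ≡.≡-Reasoning

  nCk*k!*[n∸k]!≡n! : ∀ {n k} → k ≤ n → (n C k) * (k ! * (n ∸ k) !) ≡ n !
  nCk*k!*[n∸k]!≡n! {n} {k} k≤n = begin
    (n C k) * (k ! * (n ∸ k) !)
      ≡⟨ cong (_* (k ! * (n ∸ k) !)) (nCk≡n!/k![n-k]! k≤n) ⟩
    (n ! / (k ! * (n ∸ k) !)) * (k ! * (n ∸ k) !)
      ≡⟨ m/n*n≡m (k![n∸k]!∣n! k≤n) ⟩
    n ! ∎
    where
    instance
      k![n∸k]!≢0 : NonZero (k ! * (n ∸ k) !)
      k![n∸k]!≢0 = k !* (n ∸ k) !≢0

  nCk*[n∸k]Cj*k!*j!*[n∸[k+j]]!≡n! : ∀ n k j → k + j ≤ n →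
    (n C k) * ((n ∸ k) C j) * (k ! * j ! * (n ∸ (k + j)) !) ≡ n !
  nCk*[n∸k]Cj*k!*j!*[n∸[k+j]]!≡n! n k j k+j≤n = begin
    (n C k) * ((n ∸ k) C j) * (k ! * j ! * (n ∸ (k + j)) !)
      ≡⟨ cong (λ m → (n C k) * ((n ∸ k) C j) * (k ! * j ! * m !)) (sym (∸-+-assoc n k j)) ⟩
    (n C k) * ((n ∸ k) C j) * (k ! * j ! * (n ∸ k ∸ j) !)
      ≡⟨ regroup (n C k) ((n ∸ k) C j) (k !) (j !) ((n ∸ k ∸ j) !) ⟩
    (n C k) * (k ! * (((n ∸ k) C j) * (j ! * (n ∸ k ∸ j) !)))
      ≡⟨ cong (λ m → (n C k) * (k ! * m)) (nCk*k!*[n∸k]!≡n! j≤n∸k) ⟩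
    (n C k) * (k ! * (n ∸ k) !)
      ≡⟨ nCk*k!*[n∸k]!≡n! (m+n≤o⇒m≤o k k+j≤n) ⟩
    n ! ∎
    where
    regroup : ∀ a b x y z → a * b * (x * y * z) ≡ a * (x * (b * (y * z)))
    regroup = ℕ-solve-∀
    j≤n∸k : j ≤ n ∸ k
    j≤n∸k = m+n≤o⇒m≤o∸n j (≤-trans (≤-reflexive (+-comm j k)) k+j≤n)

  nCk*[n∸k]Cj≡0 : ∀ n k j → n < k + j → (n C k) * ((n ∸ k) C j) ≡ 0
  nCk*[n∸k]Cj≡0 n k j n<k+j with k ≤? n
  ... | no k≰n = cong (_* ((n ∸ k) C j)) (k>n⇒nCk≡0 (≰⇒> k≰n))
  ... | yes k≤n = trans (cong ((n C k) *_) (k>n⇒nCk≡0 n∸k<j)) (*-zeroʳ (n C k))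
    where
    n∸k<j : n ∸ k < j
    n∸k<j = ≤-trans (∸-monoˡ-< n<k+j k≤n) (≤-reflexive (m+n∸m≡n k j))

  nCk*[n∸k]Cj≡nCj*[n∸j]Ck : ∀ n k j → (n C k) * ((n ∸ k) C j) ≡ (n C j) * ((n ∸ j) C k)
  nCk*[n∸k]Cj≡nCj*[n∸j]Ck n k j with k + j ≤? n
  ... | no k+j≰n = trans (nCk*[n∸k]Cj≡0 n k j (≰⇒> k+j≰n))
                         (sym (nCk*[n∸k]Cj≡0 n j k (≤-trans (≰⇒> k+j≰n) (≤-reflexive (+-comm k j)))))
  ... | yes k+j≤n = *-cancelʳ-≡ _ _ (k ! * j ! * (n ∸ (k + j)) !) {{factorials≢0}} (begin
    (n C k) * ((n ∸ k) C j) * (k ! * j ! * (n ∸ (k + j)) !)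
      ≡⟨ nCk*[n∸k]Cj*k!*j!*[n∸[k+j]]!≡n! n k j k+j≤n ⟩
    n !
      ≡⟨ nCk*[n∸k]Cj*k!*j!*[n∸[k+j]]!≡n! n j k (≤-trans (≤-reflexive (+-comm j k)) k+j≤n) ⟨
    (n C j) * ((n ∸ j) C k) * (j ! * k ! * (n ∸ (j + k)) !)
      ≡⟨ cong ((n C j) * ((n ∸ j) C k) *_)
              (cong₂ (λ a b → a * (n ∸ b) !) (*-comm (j !) (k !)) (+-comm j k)) ⟩
    (n C j) * ((n ∸ j) C k) * (k ! * j ! * (n ∸ (k + j)) !) ∎)
    where
    factorials≢0 : NonZero (k ! * j ! * (n ∸ (k + j)) !)
    factorials≢0 = m*n≢0 _ _ {{k !* j !≢0}} {{(n ∸ (k + j)) !≢0}}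

module _ {a ℓ : Level} (R : CommutativeRing a ℓ) where
  open CommutativeRing R hiding (zero)
  open import Algebra.Properties.Ring ring
    using (-1*x≈-x; -‿distribˡ-*; -‿involutive; -‿+-comm; x[y-z]≈xy-xz)
  open import Algebra.Properties.CommutativeSemigroup *-commutativeSemigroup using (x∙yz≈y∙xz)
  open import Algebra.Properties.CommutativeSemigroup +-commutativeSemigroup
    using () renaming (interchange to +-interchange)
  open import Algebra.Properties.CommutativeSemiring.Exp commutativeSemiring
    using (_^_; ^-congˡ; ^-distrib-*)
  open import Algebra.Properties.Semiring.Mult semiring using (_×_; ×-homo-+; ×1-homo-*)
  open import Relation.Binary.Reasoning.Setoid setoid

  x-[x+y]≈-y : ∀ x y → x - (x + y) ≈ - y
  x-[x+y]≈-y x y = begin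
    x + - (x + y)      ≈⟨ +-congˡ (-‿+-comm x y) ⟨
    x + (- x + - y)    ≈⟨ +-assoc x (- x) (- y) ⟨
    (x + - x) + - y    ≈⟨ +-congʳ (-‿inverseʳ x) ⟩
    0# + - y           ≈⟨ +-identityˡ (- y) ⟩
    - y                ∎

  fromℕ≈×1# : ∀ m → fromℕ R m ≈ m × 1#
  fromℕ≈×1# zero    = refl
  fromℕ≈×1# (suc m) = +-congˡ (fromℕ≈×1# m)

  fromℕ-+ : ∀ m n → fromℕ R (m ℕ.+ n) ≈ fromℕ R m + fromℕ R n
  fromℕ-+ m n = begin
    fromℕ R (m ℕ.+ n)         ≈⟨ fromℕ≈×1# (m ℕ.+ n) ⟩
    (m ℕ.+ n) × 1#            ≈⟨ ×-homo-+ 1# m n ⟩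
    m × 1# + n × 1#           ≈⟨ +-cong (fromℕ≈×1# m) (fromℕ≈×1# n) ⟨
    fromℕ R m + fromℕ R n     ∎

  fromℕ-* : ∀ m n → fromℕ R (m ℕ.* n) ≈ fromℕ R m * fromℕ R n
  fromℕ-* m n = begin
    fromℕ R (m ℕ.* n)         ≈⟨ fromℕ≈×1# (m ℕ.* n) ⟩
    (m ℕ.* n) × 1#            ≈⟨ ×1-homo-* m n ⟩
    m × 1# * n × 1#           ≈⟨ *-cong (fromℕ≈×1# m) (fromℕ≈×1# n) ⟨
    fromℕ R m * fromℕ R n     ∎

  fromℕ-^ : ∀ m k → fromℕ R (m ℕ.^ k) ≈ fromℕ R m ^ k
  fromℕ-^ m zero    = +-identityʳ 1#
  fromℕ-^ m (suc k) = trans (fromℕ-* m (m ℕ.^ k)) (*-congˡ (fromℕ-^ m k))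

  fromℕ-cong : ∀ {m n} → m ≡ n → fromℕ R m ≈ fromℕ R n
  fromℕ-cong = reflexive ∘ ≡.cong (fromℕ R)

  fromℕ-*-exchange : ∀ {m n m′ n′} → m ℕ.* n ≡ m′ ℕ.* n′ → ∀ x →
                     fromℕ R m * (fromℕ R n * x) ≈ fromℕ R m′ * (fromℕ R n′ * x)
  fromℕ-*-exchange {m} {n} {m′} {n′} mn≡m′n′ x = begin
    fromℕ R m * (fromℕ R n * x)     ≈⟨ *-assoc _ _ x ⟨
    fromℕ R m * fromℕ R n * x       ≈⟨ *-congʳ (fromℕ-* m n) ⟨
    fromℕ R (m ℕ.* n) * x           ≈⟨ *-congʳ (fromℕ-cong mn≡m′n′) ⟩
    fromℕ R (m′ ℕ.* n′) * x         ≈⟨ *-congʳ (fromℕ-* m′ n′) ⟩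
    fromℕ R m′ * fromℕ R n′ * x     ≈⟨ *-assoc _ _ x ⟩
    fromℕ R m′ * (fromℕ R n′ * x)   ∎

  neg1^≈-1^ : ∀ k → neg1^ R k ≈ (- 1#) ^ k
  neg1^≈-1^ zero    = refl
  neg1^≈-1^ (suc k) = trans (-‿cong (neg1^≈-1^ k)) (sym (-1*x≈-x _))

  neg1^-+ : ∀ m n → neg1^ R (m ℕ.+ n) ≈ neg1^ R m * neg1^ R n
  neg1^-+ zero    n = sym (*-identityˡ _)
  neg1^-+ (suc m) n = trans (-‿cong (neg1^-+ m n)) (-‿distribˡ-* _ _)

  neg1^-double : ∀ k → neg1^ R (k ℕ.+ k) ≈ 1#
  neg1^-double zero    = refl
  neg1^-double (suc k) = begin
    - neg1^ R (k ℕ.+ suc k)      ≡⟨ ≡.cong (-_ ∘ neg1^ R) (ℕ.+-suc k k) ⟩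
    - - neg1^ R (k ℕ.+ k)        ≈⟨ -‿involutive _ ⟩
    neg1^ R (k ℕ.+ k)            ≈⟨ neg1^-double k ⟩
    1#                           ∎

  neg1^-∸ : ∀ {n k} → k ≤ n → neg1^ R (n ∸ k) ≈ signDiff R n k
  neg1^-∸ {n} {k} k≤n = begin
    neg1^ R (n ∸ k)                              ≈⟨ *-identityʳ _ ⟨
    neg1^ R (n ∸ k) * 1#                         ≈⟨ *-congˡ (neg1^-double k) ⟨
    neg1^ R (n ∸ k) * neg1^ R (k ℕ.+ k)          ≈⟨ neg1^-+ (n ∸ k) (k ℕ.+ k) ⟨
    neg1^ R (n ∸ k ℕ.+ (k ℕ.+ k))                ≡⟨ ≡.cong (neg1^ R) n∸k+[k+k]≡n+k ⟩
    neg1^ R (n ℕ.+ k)                            ∎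
    where
    n∸k+[k+k]≡n+k : n ∸ k ℕ.+ (k ℕ.+ k) ≡ n ℕ.+ k
    n∸k+[k+k]≡n+k = ≡.trans (≡.sym (ℕ.+-assoc (n ∸ k) k k)) (≡.cong (ℕ._+ k) (ℕ.m∸n+n≡m k≤n))

  signDiff-+ˡ : ∀ a b k → signDiff R (a ℕ.+ b) k ≈ neg1^ R a * signDiff R b k
  signDiff-+ˡ a b k = trans (reflexive (≡.cong (neg1^ R) (ℕ.+-assoc a b k))) (neg1^-+ a (b ℕ.+ k))

  Σ≤-cong : ∀ n {f g} → (∀ k → k ≤ n → f k ≈ g k) → Σ≤ R n f ≈ Σ≤ R n g
  Σ≤-cong zero    f≈g = f≈g 0 z≤n
  Σ≤-cong (suc n) f≈g =
    +-cong (Σ≤-cong n (λ k k≤n → f≈g k (m≤n⇒m≤1+n k≤n))) (f≈g (suc n) ≤-refl)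

  Σ≤-+ : ∀ n f g → Σ≤ R n (λ k → f k + g k) ≈ Σ≤ R n f + Σ≤ R n g
  Σ≤-+ zero    f g = refl
  Σ≤-+ (suc n) f g = trans (+-congʳ (Σ≤-+ n f g)) (+-interchange _ _ _ _)

  Σ≤-distribˡ : ∀ n x f → Σ≤ R n (λ k → x * f k) ≈ x * Σ≤ R n f
  Σ≤-distribˡ zero    x f = refl
  Σ≤-distribˡ (suc n) x f = trans (+-congʳ (Σ≤-distribˡ n x f)) (sym (distribˡ x _ _))

  Σ≤-zero : ∀ n f → (∀ k → k ≤ n → f k ≈ 0#) → Σ≤ R n f ≈ 0#
  Σ≤-zero n f f≈0 = trans (Σ≤-cong n f≈0) (Σ≤-const n)
    where
    Σ≤-const : ∀ n → Σ≤ R n (λ _ → 0#) ≈ 0#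
    Σ≤-const zero    = refl
    Σ≤-const (suc n) = trans (+-identityʳ _) (Σ≤-const n)

  Σ≤-suc : ∀ n f → Σ≤ R (suc n) f ≈ f 0 + Σ≤ R n (f ∘ suc)
  Σ≤-suc zero    f = refl
  Σ≤-suc (suc n) f = trans (+-congʳ (Σ≤-suc n f)) (+-assoc _ _ _)

  Σ≤-+-tail : ∀ m n f → (∀ k → n < k → f k ≈ 0#) → Σ≤ R (m ℕ.+ n) f ≈ Σ≤ R n f
  Σ≤-+-tail zero    n f tail≈0 = refl
  Σ≤-+-tail (suc m) n f tail≈0 =
    trans (+-cong (Σ≤-+-tail m n f tail≈0) (tail≈0 _ (s≤s (ℕ.m≤n+m n m)))) (+-identityʳ _)

  binomialSum : ℕ → (ℕ → Carrier) → Carrier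
  binomialSum n g = Σ≤ R n (λ k → fromℕ R (n C k) * g k)

  binomialSum-cong : ∀ n {g h} → (∀ k → k ≤ n → g k ≈ h k) → binomialSum n g ≈ binomialSum n h
  binomialSum-cong n g≈h = Σ≤-cong n (λ k k≤n → *-congˡ (g≈h k k≤n))

  binomialSum-+ : ∀ n g h → binomialSum n (λ k → g k + h k) ≈ binomialSum n g + binomialSum n h
  binomialSum-+ n g h = trans (Σ≤-cong n (λ k _ → distribˡ _ (g k) (h k))) (Σ≤-+ n _ _)

  binomialSum-distribˡ : ∀ n x g → binomialSum n (λ k → x * g k) ≈ x * binomialSum n g
  binomialSum-distribˡ n x g = trans (Σ≤-cong n (λ k _ → x∙yz≈y∙xz _ x (g k))) (Σ≤-distribˡ n x _)

  binomialSum-factor : ∀ n x (u v g : ℕ → Carrier) → (∀ k → u k ≈ x * v k) →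
                       binomialSum n (λ k → u k * g k) ≈ x * binomialSum n (λ k → v k * g k)
  binomialSum-factor n x u v g u≈xv =
    trans (binomialSum-cong n (λ k _ → trans (*-congʳ (u≈xv k)) (*-assoc x _ (g k))))
          (binomialSum-distribˡ n x _)

  binomialSum-suc : ∀ n g → binomialSum (suc n) g ≈ binomialSum n g + binomialSum n (g ∘ suc)
  binomialSum-suc n g = begin
    binomialSum (suc n) g
      ≈⟨ Σ≤-suc n _ ⟩
    fromℕ R 1 * g 0 + Σ≤ R n (λ k → fromℕ R (suc n C suc k) * g (suc k))
      ≈⟨ +-congˡ (Σ≤-cong n (λ k _ → pascal k)) ⟩
    fromℕ R 1 * g 0 + Σ≤ R n (λ k → fromℕ R (n C k) * g (suc k) + fromℕ R (n C suc k) * g (suc k))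
      ≈⟨ +-congˡ (trans (Σ≤-+ n _ _) (+-comm _ _)) ⟩
    fromℕ R 1 * g 0 + (Σ≤ R n (λ k → fromℕ R (n C suc k) * g (suc k)) + binomialSum n (g ∘ suc))
      ≈⟨ +-assoc _ _ _ ⟨
    (fromℕ R 1 * g 0 + Σ≤ R n (λ k → fromℕ R (n C suc k) * g (suc k))) + binomialSum n (g ∘ suc)
      ≈⟨ +-congʳ (Σ≤-suc n _) ⟨
    Σ≤ R (suc n) (λ k → fromℕ R (n C k) * g k) + binomialSum n (g ∘ suc)
      ≈⟨ +-congʳ (+-congˡ (trans (*-congʳ (fromℕ-cong (k>n⇒nCk≡0 (ℕ.n<1+n n)))) (zeroˡ _))) ⟩
    (binomialSum n g + 0#) + binomialSum n (g ∘ suc)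
      ≈⟨ +-congʳ (+-identityʳ _) ⟩
    binomialSum n g + binomialSum n (g ∘ suc) ∎
    where
    pascal : ∀ k → fromℕ R (suc n C suc k) * g (suc k)
                   ≈ fromℕ R (n C k) * g (suc k) + fromℕ R (n C suc k) * g (suc k)
    pascal k = trans (*-congʳ (trans (fromℕ-cong (≡.sym (nCk+nC[k+1]≡[n+1]C[k+1] n k)))
                                     (fromℕ-+ (n C k) (n C suc k))))
                     (distribʳ _ _ _)

  binomialTransform : (ℕ → Carrier) → ℕ → Carrier
  binomialTransform t n = binomialSum n (λ k → neg1^ R k * t k)

  BinomialPair₁⇒≈binomialTransform : ∀ {s σ} → BinomialPair₁ R s σ →
                                     ∀ n → σ n ≈ binomialTransform s n
  BinomialPair₁⇒≈binomialTransform pair n = trans (pair n) (Σ≤-cong n (λ k _ → x∙yz≈y∙xz _ _ _))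

  binomialTransform-suc : ∀ t n →
    binomialTransform t (suc n) ≈ binomialTransform t n - binomialTransform (t ∘ suc) n
  binomialTransform-suc t n = begin
    binomialTransform t (suc n)
      ≈⟨ binomialSum-suc n _ ⟩
    binomialTransform t n + binomialSum n (λ k → (- neg1^ R k) * t (suc k))
      ≈⟨ +-congˡ (binomialSum-factor n (- 1#) _ _ _ (λ k → sym (-1*x≈-x _))) ⟩
    binomialTransform t n + - 1# * binomialTransform (t ∘ suc) n
      ≈⟨ +-congˡ (-1*x≈-x _) ⟩
    binomialTransform t n - binomialTransform (t ∘ suc) n ∎

  module _ (c : Carrier) where

    Recurrence : (ℕ → (ℕ → Carrier) → Carrier) → Set (a ⊔ ℓ)
    Recurrence X = ∀ n t → X (suc n) t ≈ (1# + c) * X n t + (- c) * X n (t ∘ suc)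

    recurrence-unique : ∀ {X Y} → Recurrence X → Recurrence Y → (∀ t → X 0 t ≈ Y 0 t) →
                        ∀ n t → X n t ≈ Y n t
    recurrence-unique recX recY X₀≈Y₀ zero    t = X₀≈Y₀ t
    recurrence-unique {X} {Y} recX recY X₀≈Y₀ (suc n) t = begin
      X (suc n) t
        ≈⟨ recX n t ⟩
      (1# + c) * X n t + (- c) * X n (t ∘ suc)
        ≈⟨ +-cong (*-congˡ (X≈Y n t)) (*-congˡ (X≈Y n (t ∘ suc))) ⟩
      (1# + c) * Y n t + (- c) * Y n (t ∘ suc)
        ≈⟨ recY n t ⟨
      Y (suc n) t ∎
      where
      X≈Y : ∀ n t → X n t ≈ Y n t
      X≈Y = recurrence-unique recX recY X₀≈Y₀

    transformSum : ℕ → (ℕ → Carrier) → Carrier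
    transformSum n t = binomialSum n (λ k → c ^ k * binomialTransform t k)

    closedFormSum : ℕ → (ℕ → Carrier) → Carrier
    closedFormSum n t = binomialSum n (λ k → (- c) ^ k * ((1# + c) ^ (n ∸ k) * t k))

    transformSum-recurrence : Recurrence transformSum
    transformSum-recurrence n t = begin
      transformSum (suc n) t
        ≈⟨ binomialSum-suc n _ ⟩
      transformSum n t + binomialSum n (λ k → c * c ^ k * binomialTransform t (suc k))
        ≈⟨ +-congˡ (binomialSum-cong n (λ k _ → trans (*-congˡ (binomialTransform-suc t k))
                                                        (split _ _ _))) ⟩
      transformSum n t + binomialSum n (λ k → c * (c ^ k * binomialTransform t k)
                                              + (- c) * (c ^ k * binomialTransform (t ∘ suc) k))
        ≈⟨ +-congˡ (trans (binomialSum-+ n _ _)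
                          (+-cong (binomialSum-distribˡ n c _) (binomialSum-distribˡ n (- c) _))) ⟩
      transformSum n t + (c * transformSum n t + (- c) * transformSum n (t ∘ suc))
        ≈⟨ +-assoc _ _ _ ⟨
      (transformSum n t + c * transformSum n t) + (- c) * transformSum n (t ∘ suc)
        ≈⟨ +-congʳ (trans (distribʳ _ 1# c) (+-congʳ (*-identityˡ _))) ⟨
      (1# + c) * transformSum n t + (- c) * transformSum n (t ∘ suc) ∎
      where
      split : ∀ x y z → c * x * (y - z) ≈ c * (x * y) + (- c) * (x * z)
      split x y z = trans (x[y-z]≈xy-xz (c * x) y z)
                          (+-cong (*-assoc c x y) (trans (-‿cong (*-assoc c x z)) (-‿distribˡ-* c (x * z))))

    closedFormSum-recurrence : Recurrence closedFormSum
    closedFormSum-recurrence n t = begin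
      closedFormSum (suc n) t
        ≈⟨ binomialSum-suc n _ ⟩
      binomialSum n (λ k → (- c) ^ k * ((1# + c) ^ (suc n ∸ k) * t k))
        + binomialSum n (λ k → (- c) * (- c) ^ k * ((1# + c) ^ (n ∸ k) * t (suc k)))
        ≈⟨ +-cong (binomialSum-cong n lower) (binomialSum-cong n (λ k _ → *-assoc _ _ _)) ⟩
      binomialSum n (λ k → (1# + c) * ((- c) ^ k * ((1# + c) ^ (n ∸ k) * t k)))
        + binomialSum n (λ k → (- c) * ((- c) ^ k * ((1# + c) ^ (n ∸ k) * t (suc k))))
        ≈⟨ +-cong (binomialSum-distribˡ n _ _) (binomialSum-distribˡ n _ _) ⟩
      (1# + c) * closedFormSum n t + (- c) * closedFormSum n (t ∘ suc) ∎
      where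
      lower : ∀ k → k ≤ n → (- c) ^ k * ((1# + c) ^ (suc n ∸ k) * t k)
                             ≈ (1# + c) * ((- c) ^ k * ((1# + c) ^ (n ∸ k) * t k))
      lower k k≤n = begin
        (- c) ^ k * ((1# + c) ^ (suc n ∸ k) * t k)
          ≡⟨ ≡.cong (λ m → (- c) ^ k * ((1# + c) ^ m * t k)) (ℕ.+-∸-assoc 1 k≤n) ⟩
        (- c) ^ k * ((1# + c) * (1# + c) ^ (n ∸ k) * t k)
          ≈⟨ *-congˡ (*-assoc _ _ _) ⟩
        (- c) ^ k * ((1# + c) * ((1# + c) ^ (n ∸ k) * t k))
          ≈⟨ x∙yz≈y∙xz _ _ _ ⟩
        (1# + c) * ((- c) ^ k * ((1# + c) ^ (n ∸ k) * t k)) ∎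

    transformSum≈closedFormSum : ∀ n t → transformSum n t ≈ closedFormSum n t
    transformSum≈closedFormSum = recurrence-unique transformSum-recurrence closedFormSum-recurrence
      (λ t → *-congˡ (*-congˡ (trans (*-congʳ (+-identityʳ 1#)) (*-identityˡ _))))

  BinomialPair₁⇒doubledSum : ∀ {s σ} → BinomialPair₁ R s σ → ∀ n →
    binomialSum n (λ k → neg1^ R k * (fromℕ R (2 ℕ.^ k) * σ k))
      ≈ binomialSum n (λ k → signDiff R n k * (fromℕ R (2 ℕ.^ k) * s k))
  BinomialPair₁⇒doubledSum {s} {σ} pair n = begin
    binomialSum n (λ k → neg1^ R k * (fromℕ R (2 ℕ.^ k) * σ k))
      ≈⟨ binomialSum-cong n (λ k _ → trans (sym (*-assoc _ _ _))
                                           (*-cong (sym (c^k k)) (BinomialPair₁⇒≈binomialTransform pair k))) ⟩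
    transformSum c n s
      ≈⟨ transformSum≈closedFormSum c n s ⟩
    closedFormSum c n s
      ≈⟨ binomialSum-cong n (λ k k≤n → trans (*-cong ([-c]^k k) (*-congʳ ([1+c]^[n∸k] k≤n)))
                                             (x∙yz≈y∙xz _ _ _)) ⟩
    binomialSum n (λ k → signDiff R n k * (fromℕ R (2 ℕ.^ k) * s k)) ∎
    where
    two c : Carrier
    two = fromℕ R 2
    c = - two
    c^k : ∀ k → c ^ k ≈ neg1^ R k * fromℕ R (2 ℕ.^ k)
    c^k k = begin
      (- two) ^ k                      ≈⟨ ^-congˡ k (-1*x≈-x two) ⟨
      (- 1# * two) ^ k                 ≈⟨ ^-distrib-* (- 1#) two k ⟩
      (- 1#) ^ k * two ^ k             ≈⟨ *-cong (neg1^≈-1^ k) (fromℕ-^ 2 k) ⟨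
      neg1^ R k * fromℕ R (2 ℕ.^ k)    ∎
    [-c]^k : ∀ k → (- c) ^ k ≈ fromℕ R (2 ℕ.^ k)
    [-c]^k k = trans (^-congˡ k (-‿involutive two)) (sym (fromℕ-^ 2 k))
    1-2≈-1 : 1# + c ≈ - 1#
    1-2≈-1 = trans (x-[x+y]≈-y 1# (1# + 0#)) (-‿cong (+-identityʳ 1#))
    [1+c]^[n∸k] : ∀ {k} → k ≤ n → (1# + c) ^ (n ∸ k) ≈ signDiff R n k
    [1+c]^[n∸k] {k} k≤n = begin
      (1# + c) ^ (n ∸ k)   ≈⟨ ^-congˡ (n ∸ k) 1-2≈-1 ⟩
      (- 1#) ^ (n ∸ k)     ≈⟨ neg1^≈-1^ (n ∸ k) ⟨
      neg1^ R (n ∸ k)      ≈⟨ neg1^-∸ k≤n ⟩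
      signDiff R n k       ∎

  Σ≤-nCk*[n∸k]Cj : ∀ j m (u v : ℕ → Carrier) →
    Σ≤ R (j ℕ.+ m) (λ k → u k * (fromℕ R ((j ℕ.+ m) C k) * (fromℕ R ((j ℕ.+ m ∸ k) C j) * v k)))
      ≈ fromℕ R ((j ℕ.+ m) C j) * binomialSum m (λ k → u k * v k)
  Σ≤-nCk*[n∸k]Cj j m u v = begin
    Σ≤ R (j ℕ.+ m) (λ k → u k * (fromℕ R ((j ℕ.+ m) C k) * (fromℕ R ((j ℕ.+ m ∸ k) C j) * v k)))
      ≈⟨ Σ≤-cong (j ℕ.+ m) (λ k _ → revision k) ⟩
    Σ≤ R (j ℕ.+ m) (λ k → fromℕ R ((j ℕ.+ m) C j) * (fromℕ R (m C k) * (u k * v k)))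
      ≈⟨ Σ≤-+-tail j m _ (λ k m<k → vanish k m<k) ⟩
    Σ≤ R m (λ k → fromℕ R ((j ℕ.+ m) C j) * (fromℕ R (m C k) * (u k * v k)))
      ≈⟨ Σ≤-distribˡ m _ _ ⟩
    fromℕ R ((j ℕ.+ m) C j) * binomialSum m (λ k → u k * v k) ∎
    where
    revision : ∀ k → u k * (fromℕ R ((j ℕ.+ m) C k) * (fromℕ R ((j ℕ.+ m ∸ k) C j) * v k))
                     ≈ fromℕ R ((j ℕ.+ m) C j) * (fromℕ R (m C k) * (u k * v k))
    revision k = trans (trans (x∙yz≈y∙xz _ _ _) (*-congˡ (x∙yz≈y∙xz _ _ _)))
                       (fromℕ-*-exchange {(j ℕ.+ m) C k} {(j ℕ.+ m ∸ k) C j} {(j ℕ.+ m) C j} {m C k}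
                                         [j+m]Ck*[j+m∸k]Cj≡[j+m]Cj*mCk _)
      where
      [j+m]Ck*[j+m∸k]Cj≡[j+m]Cj*mCk :
        ((j ℕ.+ m) C k) ℕ.* ((j ℕ.+ m ∸ k) C j) ≡ ((j ℕ.+ m) C j) ℕ.* (m C k)
      [j+m]Ck*[j+m∸k]Cj≡[j+m]Cj*mCk =
        ≡.trans (nCk*[n∸k]Cj≡nCj*[n∸j]Ck (j ℕ.+ m) k j)
                (≡.cong (λ i → ((j ℕ.+ m) C j) ℕ.* (i C k)) (ℕ.m+n∸m≡n j m))
    vanish : ∀ k → m < k → fromℕ R ((j ℕ.+ m) C j) * (fromℕ R (m C k) * (u k * v k)) ≈ 0#
    vanish k m<k = trans (*-congˡ (trans (*-congʳ (fromℕ-cong (k>n⇒nCk≡0 m<k))) (zeroˡ _))) (zeroʳ _)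

  Σ≤-nCk*[n∸k]Cj≈0 : ∀ {n j} → n < j → ∀ (u v : ℕ → Carrier) →
    Σ≤ R n (λ k → u k * (fromℕ R (n C k) * (fromℕ R ((n ∸ k) C j) * v k))) ≈ 0#
  Σ≤-nCk*[n∸k]Cj≈0 {n} {j} n<j u v = Σ≤-zero n _ (λ k _ → begin
    u k * (fromℕ R (n C k) * (fromℕ R ((n ∸ k) C j) * v k))
      ≈⟨ *-congˡ (*-congˡ (*-congʳ (fromℕ-cong (k>n⇒nCk≡0 (n∸k<j k))))) ⟩
    u k * (fromℕ R (n C k) * (0# * v k))
      ≈⟨ *-congˡ (trans (*-congˡ (zeroˡ _)) (zeroʳ _)) ⟩
    u k * 0#
      ≈⟨ zeroʳ _ ⟩
    0# ∎)
    where
    n∸k<j : ∀ k → n ∸ k < j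
    n∸k<j k = ℕ.≤-<-trans (ℕ.m∸n≤m n k) n<j

-- Imported only now: inside the module above, _^_ is exponentiation in the ring.
open import Data.Nat.Base using (_^_)

theorem24 : ∀ {c ℓ : Level} (R : CommutativeRing c ℓ) →
    let open CommutativeRing R in
    (s σ : ℕ → Carrier) → BinomialPair₁ R s σ → (j n : ℕ) →
    Σ≤ R n (λ k → signDiff R n k * (fromℕ R (n C k) * (fromℕ R ((n ∸ k) C j) * (fromℕ R (2 ^ k) * s k))))
      ≈ Σ≤ R n (λ k → signDiff R j k * (fromℕ R (n C k) * (fromℕ R ((n ∸ k) C j) * (fromℕ R (2 ^ k) * σ k))))
theorem24 R s σ pair j n with j ℕ.≤? n
... | no j≰n = let open CommutativeRing R in
  trans (Σ≤-nCk*[n∸k]Cj≈0 R (ℕ.≰⇒> j≰n) _ _) (sym (Σ≤-nCk*[n∸k]Cj≈0 R (ℕ.≰⇒> j≰n) _ _))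
... | yes j≤n with ℕ.m≤n⇒∃[o]m+o≡n j≤n
...   | m , ≡.refl = begin
  _ ≈⟨ Σ≤-nCk*[n∸k]Cj R j m _ _ ⟩
  [j+m]Cj * binomialSum R m (λ k → signDiff R (j ℕ.+ m) k * pow2 s k)
    ≈⟨ *-congˡ (binomialSum-factor R m (neg1^ R j) _ _ _ (signDiff-+ˡ R j m)) ⟩
  [j+m]Cj * (neg1^ R j * binomialSum R m (λ k → signDiff R m k * pow2 s k))
    ≈⟨ *-congˡ (*-congˡ (BinomialPair₁⇒doubledSum R pair m)) ⟨
  [j+m]Cj * (neg1^ R j * binomialSum R m (λ k → neg1^ R k * pow2 σ k))
    ≈⟨ *-congˡ (binomialSum-factor R m (neg1^ R j) _ _ _ (neg1^-+ R j)) ⟨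
  [j+m]Cj * binomialSum R m (λ k → signDiff R j k * pow2 σ k)
    ≈⟨ Σ≤-nCk*[n∸k]Cj R j m _ _ ⟨
  _ ∎
  where
  open CommutativeRing R
  open import Relation.Binary.Reasoning.Setoid setoid
  [j+m]Cj : Carrier
  [j+m]Cj = fromℕ R ((j ℕ.+ m) C j)
  pow2 : (ℕ → Carrier) → ℕ → Carrier
  pow2 t k = fromℕ R (2 ^ k) * t k
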